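{- Let $G$ be a maximal planar graph with a fixed plane embedding, let $v\in V(G)$, let $S$ be a lexicographic breadth-first search tree of $G$ rooted at $v$, and let $L$, $f(u)$, $X_{f(u)}$ and $O(u)$ be as described in the context. Then for every $u\in V(G)$, every vertex of $X_{f(u)}$ is smaller with respect to $L$ than every vertex of $O(u)\setminus X_{f(u)}$.
   Context: A maximal planar graph is a simple planar graph to which no edge can be added while keeping it planar; with $|V(G)|\ge 3$ its plane embedding is a triangulation, so every face (including the outer one) is a triangle. For each vertex $w$, $P_w$ denotes the unique path in $S$ from the root $v$ to $w$. Let $T$ be the graph whose vertex set is the set of faces of $G$, where two faces are adjacent iff they share an edge of $G$ that is not an edge of $S$; for a face $t$ with vertices $a,b,c$, let $X_t=V(P_a)\cup V(P_b)\cup V(P_c)$. The linear order $L$ is built as follows: for the outer face with vertices $a,b,c$, first order the vertices of $P_a$ starting from $v$ and moving up to $a$; then order the not yet ordered vertices of $P_b$, starting from the one closest to $v$ and moving up to $b$; then likewise for $P_c$. Then perform a depth-first search on $T$ starting at the outer face; when a face $t$ is reached, at most one of the three paths forming $X_t$ contains vertices not yet ordered, and these vertices are appended to the order starting from the one closest to $v$ and moving up towards the vertex of $t$ on that path. For $u\in V(G)$, $f(u)$ is the first face, in the depth-first traversal of $T$, whose set $X_{f(u)}$ contains $u$. If $f(u)$ is the outer face, $C(u)$ is the cycle formed by its three edges; otherwise $e_u$ is the unique edge of $f(u)$ not in $S$ such that the other face containing $e_u$ was reached by the depth-first search before $f(u)$, and $C(u)$ is the unique cycle in $S+e_u$. $O(u)$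 is the set of vertices lying in the interior of $C(u)$. -}

module Defs where

open import Data.Nat using (ℕ; _+_; _*_; _≤_)
open import Data.Fin as Fin using (Fin; toℕ)
open import Data.Product using (_×_; _,_; ∃-syntax; Σ)
open import Data.Sum using (_⊎_)
open import Data.List using (List; []; _∷_; _++_; lookup; length)
open import Data.List.Membership.Propositional using (_∈_; _∉_)
open import Data.List.Relation.Unary.Unique.Propositional using (Unique)
open import Relation.Binary.PropositionalEquality using (_≡_; _≢_)
open import Relation.Binary.Construct.Closure.ReflexiveTransitive using (Star)
open import Relation.Nullary using (¬_)

-- DFS R visited stack result : starting from the given visited list and
-- stack, the search terminates with visiting order `result`.
-- A DFS from r is  DFS R (r ∷ []) (r ∷ []) result ; `result` is the
-- list of vertices in the order in which they are reached.

data DFS {A : Set} (R : A → A → Set) : List A → List A → List A → Set where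
  done : ∀ {vis} → DFS R vis [] vis
  push : ∀ {vis top st res} (u : A) → R top u → u ∉ vis →
         DFS R (vis ++ u ∷ []) (u ∷ top ∷ st) res → DFS R vis (top ∷ st) res
  pop  : ∀ {vis top st res} → (∀ u → R top u → u ∈ vis) →
         DFS R vis st res → DFS R vis (top ∷ st) res

Before : {A : Set} → List A → A → A → Set
Before L x y = ∃[ i ] ∃[ j ] (i Fin.< j × lookup L i ≡ x × lookup L j ≡ y)

-- A plane triangulation (= maximal planar graph with |V| ≥ 3 together
-- with a plane embedding), given combinatorially: vertices Fin n,
-- faces Fin m, each face an oriented (counterclockwise) triangle.

Tri : ℕ → Set
Tri n = Fin n × Fin n × Fin n

module Emb {n m : ℕ} (F : Fin m → Tri n) where

  V : Set
  V = Fin n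

  Face : Set
  Face = Fin m

  c₀ c₁ c₂ : Face → V
  c₀ t with F t
  ... | a , b , c = a
  c₁ t with F t
  ... | a , b , c = b
  c₂ t with F t
  ... | a , b , c = c

  DEdge : Face → V → V → Set
  DEdge t x y = (x ≡ c₀ t × y ≡ c₁ t) ⊎ (x ≡ c₁ t × y ≡ c₂ t) ⊎ (x ≡ c₂ t × y ≡ c₀ t)

  Corner : Face → V → Set
  Corner t x = x ≡ c₀ t ⊎ x ≡ c₁ t ⊎ x ≡ c₂ t

  Adj : V → V → Set
  Adj x y = ∃[ t ] (DEdge t x y ⊎ DEdge t y x)

  -- rotation around x: y is followed by z
  Next : V → V → V → Set
  Next x y z = ∃[ t ] (DEdge t x y × DEdge t z x)

  -- triangulation of the sphere (oriented closed connected surface,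
  -- simple, all faces triangles, Euler characteristic 2)
  record IsSphereTriangulation : Set where
    field
      three≤n      : 3 ≤ n
      distinct     : ∀ t → c₀ t ≢ c₁ t × c₁ t ≢ c₂ t × c₀ t ≢ c₂ t
      dedge-unique : ∀ s t x y → DEdge s x y → DEdge t x y → s ≡ t
      dedge-paired : ∀ s x y → DEdge s x y → ∃[ t ] DEdge t y x
      link-cycle   : ∀ x y z → Adj x y → Adj x z → Star (Next x) y z
      connected    : ∀ x y → Star Adj x y
      euler        : m + 4 ≡ 2 * n

  -- Cycles given by their (symmetric) edge predicate CE.
  -- Crossing between faces through an edge not on the cycle.
  Cross : (V → V → Set) → Face → Face → Set
  Cross CE s t = ∃[ p ] ∃[ q ] (DEdge s p q × DEdge t q p × ¬ CE p q)

  -- faces in the exterior region of the cycle (the region containing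
  -- the outer face o)
  Exterior : Face → (V → V → Set) → Face → Set
  Exterior o CE t = Star (Cross CE) o t

  InteriorVertex : Face → (V → V → Set) → V → Set
  InteriorVertex o CE y = ¬ (∃[ z ] CE y z) × ∃[ t ] (¬ Exterior o CE t × Corner t y)

  OuterCE : Face → V → V → Set
  OuterCE o p q = DEdge o p q ⊎ DEdge o q p

  -- LexBFS ordering given by pos (pos x = step at which x is numbered),
  -- rooted at v.
  module Search (v : V) (pos : V → Fin n) where

    _≺_ : V → V → Set
    x ≺ y = pos x Fin.< pos y

    -- At the step where x is chosen, the label of w is lexicographically
    -- larger than that of x.
    Beats : V → V → Set
    Beats x w = ∃[ y ] (y ≺ x × Adj y w × ¬ Adj y x ×
                  (∀ z → z ≺ y → (Adj z w → Adj z x) × (Adj z x → Adj z w)))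

    record IsLexBFS : Set where
      field
        pos-injective : ∀ x y → pos x ≡ pos y → x ≡ y
        root-first    : toℕ (pos v) ≡ 0
        lex-choice    : ∀ x w → x ≺ w → ¬ Beats x w

    -- the LexBFS tree S: parent of w is its earliest-numbered neighbour
    IsParent : V → V → Set
    IsParent p w = Adj p w × p ≺ w × (∀ y → Adj y w → pos p Fin.≤ pos y)

    -- Anc a w : a ∈ V(P_w)
    data Anc : V → V → Set where
      here : ∀ {w} → Anc w w
      up   : ∀ {a p w} → IsParent p w → Anc a p → Anc a w

    TreeEdge : V → V → Set
    TreeEdge x y = IsParent x y ⊎ IsParent y x

    X : Face → V → Set
    X t u = Anc u (c₀ t) ⊎ Anc u (c₁ t) ⊎ Anc u (c₂ t)

    TAdj : Face → Face → Set
    TAdj s t = ∃[ x ] ∃[ y ] (DEdge s x y × DEdge t y x × ¬ TreeEdge x y)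

    -- the unique cycle in S + xy : the edge xy together with the tree
    -- edges on the S-path between x and y
    SymDiff : V → V → V → Set
    SymDiff x y w = (Anc w x × ¬ Anc w y) ⊎ (Anc w y × ¬ Anc w x)

    PathCE : V → V → V → V → Set
    PathCE x y p q = ((p ≡ x × q ≡ y) ⊎ (p ≡ y × q ≡ x))
                   ⊎ (IsParent p q × SymDiff x y q) ⊎ (IsParent q p × SymDiff x y p)

    -- seg lists the vertices of P_w not in acc, from the one closest
    -- to v up towards w
    Seg : List V → V → List V → Set
    Seg acc w seg = Unique seg
                  × (∀ z → z ∈ seg → Anc z w × z ∉ acc)
                  × (∀ z → Anc z w → z ∉ acc → z ∈ seg)
                  × (∀ i j → i Fin.< j → Anc (lookup seg i) (lookup seg j))

    -- processing faces in DFS order, appending new path vertices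
    data Build : List V → List Face → List V → Set where
      finish : ∀ {acc} → Build acc [] acc
      step   : ∀ {acc t ts s₀ s₁ s₂ res} →
               Seg acc (c₀ t) s₀ → Seg (acc ++ s₀) (c₁ t) s₁ →
               Seg (acc ++ s₀ ++ s₁) (c₂ t) s₂ →
               Build (acc ++ s₀ ++ s₁ ++ s₂) ts res → Build acc (t ∷ ts) res

    -- the order L: outer face o with vertices enumerated a, b, c, then
    -- the faces in DFS order res
    data BuildL (a b c : V) (res : List Face) : List V → Set where
      buildL : ∀ {s₀ s₁ s₂ L} → Seg [] a s₀ → Seg s₀ b s₁ → Seg (s₀ ++ s₁) c s₂ →
               Build (s₀ ++ s₁ ++ s₂) res L → BuildL a b c res L

-- L is produced face by face along the DFS of T, so it splits as A ++ B
-- where A contains X_t (t = f(u)) and consists only of vertices of X_o and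
-- of X_s for faces s reached before t.  Hence it suffices to show that a
-- vertex y ∈ O(u) ∖ X_t
--   (1) occurs in L at all, and
--   (2) lies in no X_s with s = o or s reached before t.
-- For (1): the faces reached by the DFS form a set closed under crossing
-- non-tree edges, so any edge separating reached from unreached faces is a
-- tree edge; rotating around a vertex shows that such edges would climb S
-- forever, so every face (hence every vertex) is reached.
-- For (2): the faces reached before t are joined to o by T-paths avoiding
-- t, so they lie outside the cycle C(u); and every descendant of an inner
-- vertex y ∉ X_t is again inner, so y lies on no path P_w of an outer face.
--
-- When f(u) = o, (2) is immediate since L starts with X_o.
module Submission where

open import Defs
open import Function using (_∘_)
open import Data.Nat as ℕ using (ℕ; zero; suc; _+_)
import Data.Nat.Properties as ℕP
open import Data.Fin as Fin using (Fin; toℕ)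
import Data.Fin.Properties as FinP
open import Data.Product using (_×_; _,_; ∃-syntax; proj₁; proj₂)
open import Data.Sum using (_⊎_; inj₁; inj₂; swap)
import Data.Sum as Sum
open import Data.Empty using (⊥; ⊥-elim)
open import Data.List using (List; []; _∷_; _++_)
open import Data.List.Properties using (++-assoc; ++-identityʳ; ∷-injective)
open import Data.List.Membership.Propositional using (_∈_; _∉_)
open import Data.List.Membership.Propositional.Properties using (∈-++⁺ˡ; ∈-++⁺ʳ; ∈-++⁻)
import Data.List.Membership.DecPropositional as DecMembership
open import Data.List.Relation.Unary.Any using (here; there; index)
open import Data.List.Relation.Unary.Any.Properties using (lookup-index)
open import Data.List.Relation.Unary.All as All using (All)
open import Relation.Binary.PropositionalEquality
open import Relation.Binary.Definitions using (DecidableEquality)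
open import Relation.Binary.Construct.Closure.ReflexiveTransitive using (Star; ε; _◅_; _◅◅_)
open import Relation.Nullary using (¬_; Dec; yes; no)
open import Relation.Nullary.Decidable using (_×-dec_; _→-dec_)

before-++ : ∀ {A : Set} {xs ys : List A} {x y : A} → x ∈ xs → y ∈ ys → Before (xs ++ ys) x y
before-++ {xs = _ ∷ xs} {ys} {y = y} (here refl) y∈ys =
  Fin.zero , Fin.suc (index y∈) , ℕ.s≤s ℕ.z≤n , refl , sym (lookup-index y∈)
  where
  y∈ : y ∈ xs ++ ys
  y∈ = ∈-++⁺ʳ xs y∈ys
before-++ (there x∈xs) y∈ys with before-++ x∈xs y∈ys
... | i , j , i<j , Li≡x , Lj≡y = Fin.suc i , Fin.suc j , ℕ.s≤s i<j , Li≡x , Lj≡y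

before-split : ∀ {A : Set} {L xs ys : List A} {x y : A} →
  L ≡ xs ++ ys → x ∈ xs → y ∈ L → y ∉ xs → Before L x y
before-split {xs = xs} refl x∈xs y∈L y∉xs with ∈-++⁻ xs y∈L
... | inj₁ y∈xs = ⊥-elim (y∉xs y∈xs)
... | inj₂ y∈ys = before-++ x∈xs y∈ys

prefix-unique : ∀ {A : Set} {t : A} (xs ys : List A) {as bs : List A} →
  t ∉ xs → t ∉ ys → xs ++ t ∷ as ≡ ys ++ t ∷ bs → xs ≡ ys
prefix-unique [] [] _ _ _ = refl
prefix-unique [] (_ ∷ _) _ t∉ys refl = ⊥-elim (t∉ys (here refl))
prefix-unique (_ ∷ _) [] t∉xs _ refl = ⊥-elim (t∉xs (here refl))
prefix-unique (x ∷ xs) (y ∷ ys) t∉xs t∉ys eq with ∷-injective eq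
... | refl , eq′ = cong (x ∷_) (prefix-unique xs ys (t∉xs ∘ there) (t∉ys ∘ there) eq′)

Avoiding : {A : Set} → (A → A → Set) → A → A → A → Set
Avoiding R t x y = R x y × y ≢ t

module _ {A : Set} {R : A → A → Set} where

  dfs-extends : ∀ {vis st res} → DFS R vis st res → ∃[ rest ] (res ≡ vis ++ rest)
  dfs-extends done = [] , sym (++-identityʳ _)
  dfs-extends {vis} (push u _ _ d) with dfs-extends d
  ... | rest , eq = u ∷ rest , trans eq (++-assoc vis (u ∷ []) rest)
  dfs-extends (pop _ d) = dfs-extends d

  dfs-root : ∀ {r st res} → DFS R (r ∷ []) st res → r ∈ res
  dfs-root d with dfs-extends d
  ... | _ , refl = here refl

  -- Invariant: every visited vertex has all its successors visited or is
  -- still on the stack.  At the end the stack is empty.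
  dfs-closed : ∀ {vis st res} → DFS R vis st res →
    (∀ a → a ∈ vis → (∀ b → R a b → b ∈ vis) ⊎ a ∈ st) →
    ∀ a → a ∈ res → ∀ b → R a b → b ∈ res
  dfs-closed done inv a a∈ b r with inv a a∈
  ... | inj₁ closed = closed b r
  ... | inj₂ ()
  dfs-closed {vis} {top ∷ st} (push u _ _ d) inv = dfs-closed d inv′
    where
    inv′ : ∀ a → a ∈ vis ++ u ∷ [] → (∀ b → R a b → b ∈ vis ++ u ∷ []) ⊎ a ∈ u ∷ top ∷ st
    inv′ a a∈ with ∈-++⁻ vis a∈
    ... | inj₂ (here refl) = inj₂ (here refl)
    ... | inj₁ a∈vis = Sum.map (λ closed b r → ∈-++⁺ˡ (closed b r)) there (inv a a∈vis)
  dfs-closed {vis} {top ∷ st} (pop all d) inv = dfs-closed d inv′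
    where
    inv′ : ∀ a → a ∈ vis → (∀ b → R a b → b ∈ vis) ⊎ a ∈ st
    inv′ a a∈ with inv a a∈
    ... | inj₁ closed = inj₁ closed
    ... | inj₂ (here refl) = inj₁ all
    ... | inj₂ (there a∈st) = inj₂ a∈st

  dfs-complete : ∀ {r res} → DFS R (r ∷ []) (r ∷ []) res → ∀ a → a ∈ res → ∀ b → R a b → b ∈ res
  dfs-complete d = dfs-closed d (λ _ → inj₂)

  dfs-avoiding : DecidableEquality A → ∀ {vis st res} (r t : A) → DFS R vis st res → t ∉ vis →
    (∀ a → a ∈ vis → Star (Avoiding R t) r a) → (∀ a → a ∈ st → a ∈ vis) →
    ∀ pre post → res ≡ pre ++ t ∷ post → t ∉ pre →
    ∀ s → s ∈ pre → Star (Avoiding R t) r s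
  dfs-avoiding _≟_ r t done t∉vis _ _ pre post refl _ =
    ⊥-elim (t∉vis (∈-++⁺ʳ pre (here refl)))
  dfs-avoiding _≟_ {vis} {top ∷ st} r t (push u r-u _ d) t∉vis reach stack pre post eq t∉pre s s∈
    with u ≟ t
  -- t is visited now, so the vertices visited so far are exactly pre
  ... | yes refl with dfs-extends d
  ...   | rest , eq′ = reach s (subst (s ∈_) (sym vis≡pre) s∈)
    where
    vis≡pre : vis ≡ pre
    vis≡pre = prefix-unique vis pre t∉vis t∉pre
      (trans (sym (trans eq′ (++-assoc vis (t ∷ []) rest))) eq)
  dfs-avoiding _≟_ {vis} {top ∷ st} r t (push u r-u _ d) t∉vis reach stack pre post eq t∉pre s s∈
    | no u≢t = dfs-avoiding _≟_ r t d t∉vis′ reach′ stack′ pre post eq t∉pre s s∈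
    where
    t∉vis′ : t ∉ vis ++ u ∷ []
    t∉vis′ t∈ with ∈-++⁻ vis t∈
    ... | inj₁ t∈vis = t∉vis t∈vis
    ... | inj₂ (here t≡u) = u≢t (sym t≡u)
    reach′ : ∀ a → a ∈ vis ++ u ∷ [] → Star (Avoiding R t) r a
    reach′ a a∈ with ∈-++⁻ vis a∈
    ... | inj₁ a∈vis = reach a a∈vis
    ... | inj₂ (here refl) = reach top (stack top (here refl)) ◅◅ ((r-u , u≢t) ◅ ε)
    stack′ : ∀ a → a ∈ u ∷ top ∷ st → a ∈ vis ++ u ∷ []
    stack′ a (here refl) = ∈-++⁺ʳ vis (here refl)
    stack′ a (there a∈) = ∈-++⁺ˡ (stack a a∈)
  dfs-avoiding _≟_ r t (pop _ d) t∉vis reach stack =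
    dfs-avoiding _≟_ r t d t∉vis reach (λ a → stack a ∘ there)

  dfs-reaches-avoiding : DecidableEquality A → ∀ {r res} → DFS R (r ∷ []) (r ∷ []) res →
    ∀ t pre post → res ≡ pre ++ t ∷ post → t ∉ pre → t ≢ r →
    ∀ s → s ∈ pre → Star (Avoiding R t) r s
  dfs-reaches-avoiding _≟_ {r} d t pre post eq t∉pre t≢r =
    dfs-avoiding _≟_ r t d t∉root (λ { _ (here refl) → ε }) (λ _ a∈ → a∈) pre post eq t∉pre
    where
    t∉root : t ∉ r ∷ []
    t∉root (here t≡r) = t≢r t≡r

module Geometry {n m : ℕ} (F : Fin m → Tri n) (ST : Emb.IsSphereTriangulation F) where
  open Emb F
  open IsSphereTriangulation ST

  dedge-corners : ∀ {t x y} → DEdge t x y → Corner t x × Corner t y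
  dedge-corners (inj₁ (x≡ , y≡)) = inj₁ x≡ , inj₂ (inj₁ y≡)
  dedge-corners (inj₂ (inj₁ (x≡ , y≡))) = inj₂ (inj₁ x≡) , inj₂ (inj₂ y≡)
  dedge-corners (inj₂ (inj₂ (x≡ , y≡))) = inj₂ (inj₂ x≡) , inj₁ y≡

  corner-out : ∀ {t x} → Corner t x → ∃[ z ] DEdge t x z
  corner-out (inj₁ x≡) = _ , inj₁ (x≡ , refl)
  corner-out (inj₂ (inj₁ x≡)) = _ , inj₂ (inj₁ (x≡ , refl))
  corner-out (inj₂ (inj₂ x≡)) = _ , inj₂ (inj₂ (x≡ , refl))

  adj-face : ∀ {x y} → Adj x y → ∃[ t ] (Corner t x × Corner t y)
  adj-face (t , inj₁ d) = t , dedge-corners d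
  adj-face (t , inj₂ d) = t , proj₂ (dedge-corners d) , proj₁ (dedge-corners d)

  -- P passes around w: from the face before each edge wz (containing z→w)
  -- to the face after it (containing w→z).
  Propagates : V → (Face → Set) → Set
  Propagates w P = ∀ A K z → DEdge A z w → DEdge K w z → P A → P K

  rotate-along : ∀ {w} (P : Face → Set) → Propagates w P → ∀ {z₁ z₂} → Star (Next w) z₁ z₂ →
    ∀ A → DEdge A w z₁ → P A → ∀ G → DEdge G w z₂ → P G
  rotate-along P step ε A dA pA G dG = subst P (dedge-unique A G _ _ dA dG) pA
  rotate-along {w} P step ((h , dh , dh′) ◅ path) A dA pA G dG with dedge-unique h A w _ dh dA
  ... | refl with dedge-paired h _ w dh′
  ...   | K , dK = rotate-along P step path K dK (step h K _ dh′ dK pA) G dG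

  -- Since the link of w is a cycle, a property passing around w holds at
  -- all faces at w as soon as it holds at one of them.
  rotate-around : ∀ w (P : Face → Set) → Propagates w P →
    ∀ A G → Corner A w → Corner G w → P A → P G
  rotate-around w P step A G cA cG pA with corner-out cA | corner-out cG
  ... | z₁ , dA | z₂ , dG =
    rotate-along P step (link-cycle w z₁ z₂ (A , inj₁ dA) (G , inj₁ dG)) A dA pA G dG

  rotation-crossing : ∀ w (P : Face → Set) → (∀ K → Dec (P K)) →
    ∀ A G → Corner A w → Corner G w → P A → ¬ P G →
    ∃[ z ] ∃[ A′ ] ∃[ K ] (DEdge A′ z w × DEdge K w z × P A′ × ¬ P K)
  rotation-crossing w P P? A G cA cG pA ¬pG = crossing-at-G (rotate-around w Q step A G cA cG (inj₁ pA))
    where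
    Crossing : Set
    Crossing = ∃[ z ] ∃[ A′ ] ∃[ K ] (DEdge A′ z w × DEdge K w z × P A′ × ¬ P K)
    Q : Face → Set
    Q K = P K ⊎ Crossing
    step : Propagates w Q
    step A′ K z dA′ dK (inj₂ c) = inj₂ c
    step A′ K z dA′ dK (inj₁ pA′) with P? K
    ... | yes pK = inj₁ pK
    ... | no ¬pK = inj₂ (z , A′ , K , dA′ , dK , pA′ , ¬pK)
    crossing-at-G : Q G → Crossing
    crossing-at-G (inj₁ pG) = ⊥-elim (¬pG pG)
    crossing-at-G (inj₂ crossing) = crossing

module Listing {n m : ℕ} (F : Fin m → Tri n) (v : Fin n) (pos : Fin n → Fin n) where
  open Emb F
  open Search v pos
  open DecMembership (Fin._≟_ {n}) using (_∈?_)

  anc-trans : ∀ {a b c} → Anc a b → Anc b c → Anc a c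
  anc-trans a∈Pb here = a∈Pb
  anc-trans a∈Pb (up parent b∈Pp) = up parent (anc-trans a∈Pb b∈Pp)

  anc-corner : ∀ {a x t} → Anc a x → Corner t x → X t a
  anc-corner a∈Px (inj₁ refl) = inj₁ a∈Px
  anc-corner a∈Px (inj₂ (inj₁ refl)) = inj₂ (inj₁ a∈Px)
  anc-corner a∈Px (inj₂ (inj₂ refl)) = inj₂ (inj₂ a∈Px)

  pathCE-sym : ∀ {p q x y} → PathCE p q x y → PathCE p q y x
  pathCE-sym (inj₁ (inj₁ (x≡ , y≡))) = inj₁ (inj₂ (y≡ , x≡))
  pathCE-sym (inj₁ (inj₂ (x≡ , y≡))) = inj₁ (inj₁ (y≡ , x≡))
  pathCE-sym (inj₂ (inj₁ e)) = inj₂ (inj₂ e)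
  pathCE-sym (inj₂ (inj₂ e)) = inj₂ (inj₁ e)

  Anc3 : V → V → V → V → Set
  Anc3 a b c z = Anc z a ⊎ Anc z b ⊎ Anc z c

  seg-sound : ∀ {acc w seg z} → Seg acc w seg → z ∈ acc ++ seg → z ∈ acc ⊎ Anc z w
  seg-sound {acc} (_ , sound , _) z∈ with ∈-++⁻ acc z∈
  ... | inj₁ z∈acc = inj₁ z∈acc
  ... | inj₂ z∈seg = inj₂ (proj₁ (sound _ z∈seg))

  seg-complete : ∀ {acc w seg z} → Seg acc w seg → z ∈ acc ⊎ Anc z w → z ∈ acc ++ seg
  seg-complete _ (inj₁ z∈acc) = ∈-++⁺ˡ z∈acc
  seg-complete {acc} {z = z} (_ , _ , complete , _) (inj₂ z∈Pw) with z ∈? acc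
  ... | yes z∈acc = ∈-++⁺ˡ z∈acc
  ... | no z∉acc = ∈-++⁺ʳ acc (complete z z∈Pw z∉acc)

  regroup : ∀ (acc s₀ s₁ s₂ : List V) → acc ++ s₀ ++ s₁ ++ s₂ ≡ (acc ++ s₀ ++ s₁) ++ s₂
  regroup acc s₀ s₁ s₂ = begin
    acc ++ s₀ ++ s₁ ++ s₂     ≡⟨ cong (acc ++_) (sym (++-assoc s₀ s₁ s₂)) ⟩
    acc ++ (s₀ ++ s₁) ++ s₂   ≡⟨ sym (++-assoc acc (s₀ ++ s₁) s₂) ⟩
    (acc ++ s₀ ++ s₁) ++ s₂   ∎
    where open ≡-Reasoning

  segs-sound : ∀ {acc a b c s₀ s₁ s₂ z} →
    Seg acc a s₀ → Seg (acc ++ s₀) b s₁ → Seg (acc ++ s₀ ++ s₁) c s₂ →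
    z ∈ acc ++ s₀ ++ s₁ ++ s₂ → z ∈ acc ⊎ Anc3 a b c z
  segs-sound {acc} {s₀ = s₀} {s₁} {s₂} g₀ g₁ g₂ z∈
    with seg-sound g₂ (subst (_ ∈_) (regroup acc s₀ s₁ s₂) z∈)
  ... | inj₂ z∈Pc = inj₂ (inj₂ (inj₂ z∈Pc))
  ... | inj₁ z∈₂ with seg-sound g₁ (subst (_ ∈_) (sym (++-assoc acc s₀ s₁)) z∈₂)
  ...   | inj₂ z∈Pb = inj₂ (inj₂ (inj₁ z∈Pb))
  ...   | inj₁ z∈₁ = Sum.map₂ inj₁ (seg-sound g₀ z∈₁)

  seg-absorb : ∀ {acc w seg z} {Rest : Set} → Seg acc w seg →
    z ∈ acc ⊎ Anc z w ⊎ Rest → z ∈ acc ++ seg ⊎ Rest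
  seg-absorb g (inj₁ z∈acc) = inj₁ (seg-complete g (inj₁ z∈acc))
  seg-absorb g (inj₂ (inj₁ z∈Pw)) = inj₁ (seg-complete g (inj₂ z∈Pw))
  seg-absorb g (inj₂ (inj₂ rest)) = inj₂ rest

  segs-complete : ∀ {acc a b c s₀ s₁ s₂ z} →
    Seg acc a s₀ → Seg (acc ++ s₀) b s₁ → Seg (acc ++ s₀ ++ s₁) c s₂ →
    z ∈ acc ⊎ Anc3 a b c z → z ∈ acc ++ s₀ ++ s₁ ++ s₂
  segs-complete {acc} {s₀ = s₀} {s₁} {s₂} g₀ g₁ g₂ z∈ =
    subst (_ ∈_) (sym (regroup acc s₀ s₁ s₂))
      (seg-complete g₂ (Sum.map₁ (subst (_ ∈_) (++-assoc acc s₀ s₁)) (seg-absorb g₁ (seg-absorb g₀ z∈))))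

  build-extends : ∀ {acc ts L} → Build acc ts L → ∃[ rest ] (L ≡ acc ++ rest)
  build-extends finish = [] , sym (++-identityʳ _)
  build-extends {acc} (step {s₀ = s₀} {s₁} {s₂} _ _ _ b) with build-extends b
  ... | rest , eq = (s₀ ++ s₁ ++ s₂) ++ rest , trans eq (++-assoc acc (s₀ ++ s₁ ++ s₂) rest)

  build-lists : ∀ {acc ts L} → Build acc ts L → ∀ f → f ∈ ts → ∀ {z} → X f z → z ∈ L
  build-lists (step g₀ g₁ g₂ b) f (here refl) Xz with build-extends b
  ... | rest , refl = ∈-++⁺ˡ (segs-complete g₀ g₁ g₂ (inj₂ Xz))
  build-lists (step g₀ g₁ g₂ b) f (there f∈) Xz = build-lists b f f∈ Xz

  build-precedes : ∀ {acc L} pre t post → Build acc (pre ++ t ∷ post) L →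
    ∀ {x y} → X t x → y ∈ L → y ∉ acc → (∀ s → s ∈ pre → ¬ X s y) → ¬ X t y →
    Before L x y
  build-precedes {acc} [] t post (step {s₀ = s₀} {s₁} {s₂} g₀ g₁ g₂ b) {y = y} Xx y∈L y∉acc _ ¬Xty
    with build-extends b
  ... | rest , L≡ = before-split L≡ (segs-complete g₀ g₁ g₂ (inj₂ Xx)) y∈L y∉listed
    where
    y∉listed : y ∉ acc ++ s₀ ++ s₁ ++ s₂
    y∉listed y∈ with segs-sound g₀ g₁ g₂ y∈
    ... | inj₁ y∈acc = y∉acc y∈acc
    ... | inj₂ Xty = ¬Xty Xty
  build-precedes {acc} (s ∷ pre) t post (step {s₀ = s₀} {s₁} {s₂} g₀ g₁ g₂ b) {y = y} Xx y∈L y∉acc ¬Xpre ¬Xty =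
    build-precedes pre t post b Xx y∈L y∉listed (λ s′ → ¬Xpre s′ ∘ there) ¬Xty
    where
    y∉listed : y ∉ acc ++ s₀ ++ s₁ ++ s₂
    y∉listed y∈ with segs-sound g₀ g₁ g₂ y∈
    ... | inj₁ y∈acc = y∉acc y∈acc
    ... | inj₂ Xsy = ¬Xpre s (here refl) Xsy

  buildL-lists : ∀ {a b c res L} → BuildL a b c res L → ∀ f → f ∈ res → ∀ {z} → X f z → z ∈ L
  buildL-lists (buildL _ _ _ b) = build-lists b

  buildL-precedes : ∀ {o a b c res L} → Corner o a → Corner o b → Corner o c →
    BuildL a b c res L → ∀ pre t post → res ≡ pre ++ t ∷ post →
    ∀ {x y} → X t x → y ∈ L → ¬ X o y → (∀ s → s ∈ pre → ¬ X s y) → ¬ X t y →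
    Before L x y
  buildL-precedes {o} ca cb cc (buildL {s₀} {s₁} {s₂} g₀ g₁ g₂ b) pre t post refl Xx y∈L ¬Xoy =
    build-precedes pre t post b Xx y∈L (¬Xoy ∘ initial⊆Xo)
    where
    initial⊆Xo : ∀ {z} → z ∈ s₀ ++ s₁ ++ s₂ → X o z
    initial⊆Xo z∈ with segs-sound {acc = []} g₀ g₁ g₂ z∈
    ... | inj₂ (inj₁ z∈Pa) = anc-corner z∈Pa ca
    ... | inj₂ (inj₂ (inj₁ z∈Pb)) = anc-corner z∈Pb cb
    ... | inj₂ (inj₂ (inj₂ z∈Pc)) = anc-corner z∈Pc cc

module Covering {n m : ℕ} (F : Fin m → Tri n) (ST : Emb.IsSphereTriangulation F)
  (v : Fin n) (pos : Fin n → Fin n) (LB : Emb.Search.IsLexBFS F v pos)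
  (res : List (Fin m)) (closed : ∀ A → A ∈ res → ∀ B → Emb.Search.TAdj F v pos A B → B ∈ res)
  where
  open Emb F
  open Search v pos
  open IsSphereTriangulation ST
  open IsLexBFS LB
  open Geometry F ST
  open DecMembership (Fin._≟_ {m}) using (_∈?_)

  parent-unique : ∀ {p q w} → IsParent p w → IsParent q w → p ≡ q
  parent-unique (p~w , _ , p-min) (q~w , _ , q-min) =
    pos-injective _ _ (FinP.≤-antisym (p-min _ q~w) (q-min _ p~w))

  SameSide : Face → Face → Set
  SameSide A K = (A ∈ res → K ∈ res) × (K ∈ res → A ∈ res)

  sameSide? : ∀ A K → Dec (SameSide A K)
  sameSide? A K = ((A ∈? res) →-dec (K ∈? res)) ×-dec ((K ∈? res) →-dec (A ∈? res))

  Boundary : V → V → Set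
  Boundary x y = ∃[ A ] ∃[ B ] (DEdge A x y × DEdge B y x × ¬ SameSide A B)

  boundary-sym : ∀ {x y} → Boundary x y → Boundary y x
  boundary-sym (A , B , dA , dB , ¬AB) = B , A , dB , dA , λ (f , g) → ¬AB (g , f)

  -- res is closed under crossing non-tree edges, so boundary edges are
  -- tree edges
  boundary-tree : ∀ {x y} → Boundary x y → ¬ ¬ TreeEdge x y
  boundary-tree {x} {y} (A , B , dA , dB , ¬AB) ¬tree =
    ¬AB ((λ A∈ → closed A A∈ B (x , y , dA , dB , ¬tree)) ,
         (λ B∈ → closed B B∈ A (y , x , dB , dA , ¬tree ∘ swap)))

  -- The faces around w change side an even number of times, so a
  -- boundary edge wp is accompanied by another boundary edge wz.
  second-boundary : ∀ {w p} → Boundary w p → ∃[ z ] (z ≢ p × Boundary w z)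
  second-boundary {w} {p} (A , B , dA , dB , ¬AB)
    with rotation-crossing w (SameSide A) (sameSide? A) A B
           (proj₁ (dedge-corners dA)) (proj₂ (dedge-corners dB)) ((λ a → a) , (λ a → a)) ¬AB
  ... | z , A′ , K , dA′ , dK , AA′ , ¬AK = z , z≢p , K , A′ , dK , dA′ , ¬KA′
    where
    z≢p : z ≢ p
    z≢p refl = ¬AB (subst (SameSide A) (dedge-unique A′ B z w dA′ dB) AA′)
    ¬KA′ : ¬ SameSide K A′
    ¬KA′ (f , g) = ¬AK ((λ a → g (proj₁ AA′ a)) , (λ k → proj₂ AA′ (f k)))

  -- A boundary edge from w to its parent yields one from w to a child, and
  -- so on up the tree; as pos increases along the way this cannot go on
  -- for more than k steps when n ≤ pos w + k.
  no-boundary-to-parent : ∀ k {w p} → n ℕ.≤ toℕ (pos w) + k → IsParent p w → Boundary w p → ⊥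
  no-boundary-to-parent zero {w} n≤ _ _ =
    ℕP.<⇒≱ (FinP.toℕ<n (pos w)) (subst (n ℕ.≤_) (ℕP.+-identityʳ _) n≤)
  no-boundary-to-parent (suc k) {w} n≤ pw bd with second-boundary bd
  ... | z , z≢p , bdz = boundary-tree bdz λ
    { (inj₁ wz) → no-boundary-to-parent k (n≤′ wz) wz (boundary-sym bdz)
    ; (inj₂ zw) → z≢p (parent-unique zw pw) }
    where
    n≤′ : IsParent w z → n ℕ.≤ toℕ (pos z) + k
    n≤′ (_ , w≺z , _) = ℕP.≤-trans n≤ (subst (ℕ._≤ toℕ (pos z) + k) (sym (ℕP.+-suc _ k))
                          (ℕP.+-monoˡ-≤ k w≺z))

  no-boundary : ∀ {x y} → Boundary x y → ⊥
  no-boundary bd = boundary-tree bd λ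
    { (inj₁ xy) → no-boundary-to-parent n (ℕP.m≤n+m n _) xy (boundary-sym bd)
    ; (inj₂ yx) → no-boundary-to-parent n (ℕP.m≤n+m n _) yx bd }

  -- Hence membership in res passes around every vertex ...
  res-around : ∀ w → Propagates w (_∈ res)
  res-around w A K z dA dK A∈ with K ∈? res
  ... | yes K∈ = K∈
  ... | no K∉ = ⊥-elim (no-boundary (A , K , dA , dK , λ (f , _) → K∉ (f A∈)))

  -- ... and along edges, so by connectivity every vertex lies on a face
  -- of res.
  faces-along : ∀ {x y} → Star Adj x y → ∃[ E ] (Corner E x × E ∈ res) → ∃[ E ] (Corner E y × E ∈ res)
  faces-along ε face = face
  faces-along {x} (x~y ◅ path) (E , cE , E∈) with adj-face x~y
  ... | E′ , cx , cy = faces-along path (E′ , cy , rotate-around x (_∈ res) (res-around x) E E′ cE cx E∈)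

  every-vertex-covered : ∀ {o} → o ∈ res → ∀ y → ∃[ E ] (Corner E y × E ∈ res)
  every-vertex-covered {o} o∈ y = faces-along (connected (c₀ o) y) (o , inj₁ refl , o∈)

module Interior {n m : ℕ} (F : Fin m → Tri n) (ST : Emb.IsSphereTriangulation F)
  (o : Fin m) (CE : Fin n → Fin n → Set) (CE-sym : ∀ {x y} → CE x y → CE y x) where
  open Emb F
  open Geometry F ST

  Inside : V → Set
  Inside w = (∀ z → ¬ CE w z) × (∀ A → Corner A w → ¬ Exterior o CE A)

  -- Around a vertex off the cycle exteriority passes from face to face, so
  -- one non-exterior face at w suffices.
  inside-from-face : ∀ w → (∀ z → ¬ CE w z) → ∀ G → Corner G w → ¬ Exterior o CE G → Inside w
  inside-from-face w off G cG ¬extG =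
    off , λ A cA extA → ¬extG (rotate-around w (Exterior o CE) step A G cA cG extA)
    where
    step : Propagates w (Exterior o CE)
    step A K z dA dK extA = extA ◅◅ ((z , w , dA , dK , λ ce → off z (CE-sym ce)) ◅ ε)

  inside-interior : ∀ {y} → InteriorVertex o CE y → Inside y
  inside-interior {y} (off , G , ¬extG , cG) = inside-from-face y (λ z ce → off (z , ce)) G cG ¬extG

-- Inside the cycle C formed by a non-tree edge pq of a face t and the tree
-- path between p and q.
module InsideCycle {n m : ℕ} (F : Fin m → Tri n) (ST : Emb.IsSphereTriangulation F)
  (v : Fin n) (pos : Fin n → Fin n) (o t : Fin m) (p q : Fin n)
  (tpq : Emb.DEdge F t p q) where
  open Emb F
  open Search v pos
  open Geometry F ST
  open IsSphereTriangulation ST using (dedge-unique)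
  open Listing F v pos
  open Interior F ST o (PathCE p q) pathCE-sym public

  -- If y is inside C and y ∉ X_t, then so is every w with y ∈ P_w: the
  -- path from y up to w cannot meet C, which consists of tree edges
  -- towards p and q (whose paths avoid y) and the edge pq itself.
  descendant-inside : ∀ {y w} → Anc y w → Inside y → ¬ X t y → Inside w
  descendant-inside here y-in _ = y-in
  descendant-inside {y} {w} (up {p = w′} w′w y∈Pw′) y-in ¬Xty =
    inside-from-face w w-off E cw (proj₂ w′-in E cw′)
    where
    w′-in : Inside w′
    w′-in = descendant-inside y∈Pw′ y-in ¬Xty
    -- X_t is closed under taking ancestors, so w′ ∉ X_t
    ¬Xtw′ : ¬ X t w′
    ¬Xtw′ = ¬Xty ∘ Sum.map (anc-trans y∈Pw′) (Sum.map (anc-trans y∈Pw′) (anc-trans y∈Pw′))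
    w′∈Pw : Anc w′ w
    w′∈Pw = up w′w here
    w-off : ∀ z → ¬ PathCE p q w z
    w-off z (inj₁ (inj₁ (refl , _))) = ¬Xtw′ (anc-corner w′∈Pw (proj₁ (dedge-corners tpq)))
    w-off z (inj₁ (inj₂ (refl , _))) = ¬Xtw′ (anc-corner w′∈Pw (proj₂ (dedge-corners tpq)))
    w-off z (inj₂ (inj₁ (wz , inj₁ (z∈Pp , _)))) =
      ¬Xtw′ (anc-corner (anc-trans (up wz w′∈Pw) z∈Pp) (proj₁ (dedge-corners tpq)))
    w-off z (inj₂ (inj₁ (wz , inj₂ (z∈Pq , _)))) =
      ¬Xtw′ (anc-corner (anc-trans (up wz w′∈Pw) z∈Pq) (proj₂ (dedge-corners tpq)))
    w-off z (inj₂ (inj₂ (_ , w∈SymDiff))) = proj₁ w′-in w (inj₂ (inj₁ (w′w , w∈SymDiff)))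
    E : Face
    E = proj₁ (adj-face (proj₁ w′w))
    cw′ : Corner E w′
    cw′ = proj₁ (proj₂ (adj-face (proj₁ w′w)))
    cw : Corner E w
    cw = proj₂ (proj₂ (adj-face (proj₁ w′w)))

  exterior-misses : ∀ {y s} → Inside y → ¬ X t y → Exterior o (PathCE p q) s → ¬ X s y
  exterior-misses y-in ¬Xty ext (inj₁ y∈P) = proj₂ (descendant-inside y∈P y-in ¬Xty) _ (inj₁ refl) ext
  exterior-misses y-in ¬Xty ext (inj₂ (inj₁ y∈P)) = proj₂ (descendant-inside y∈P y-in ¬Xty) _ (inj₂ (inj₁ refl)) ext
  exterior-misses y-in ¬Xty ext (inj₂ (inj₂ y∈P)) = proj₂ (descendant-inside y∈P y-in ¬Xty) _ (inj₂ (inj₂ refl)) ext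

  -- The only non-tree edge of C is pq, which borders t; so a T-path
  -- avoiding t never crosses C.
  avoiding-exterior : ∀ {a b} → a ≢ t → Star (Avoiding TAdj t) a b → Star (Cross (PathCE p q)) a b
  avoiding-exterior a≢t ε = ε
  avoiding-exterior a≢t (((x , y , ax , by , ¬tree) , b≢t) ◅ path) =
    (x , y , ax , by , off-C) ◅ avoiding-exterior b≢t path
    where
    off-C : ¬ PathCE p q x y
    off-C (inj₁ (inj₁ (refl , refl))) = a≢t (dedge-unique _ _ _ _ ax tpq)
    off-C (inj₁ (inj₂ (refl , refl))) = b≢t (dedge-unique _ _ _ _ by tpq)
    off-C (inj₂ (inj₁ (xy , _))) = ¬tree (inj₁ xy)
    off-C (inj₂ (inj₂ (yx , _))) = ¬tree (inj₂ yx)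

lemma6p2 : ∀ {n m} (F : Fin m → Tri n) → Emb.IsSphereTriangulation F →
    (o : Fin m) (v : Fin n) (pos : Fin n → Fin n) → Emb.Search.IsLexBFS F v pos →
    (res : List (Fin m)) → DFS (Emb.Search.TAdj F v pos) (o ∷ []) (o ∷ []) res →
    (a b c : Fin n) → Emb.Corner F o a → Emb.Corner F o b → Emb.Corner F o c →
    a ≢ b → b ≢ c → a ≢ c →
    (L : List (Fin n)) → Emb.Search.BuildL F v pos a b c res L →
    ∀ (u : Fin n) (t : Fin m) (pre post : List (Fin m)) →
    res ≡ pre ++ t ∷ post → Emb.Search.X F v pos t u →
    All (λ s → ¬ Emb.Search.X F v pos s u) pre →
    (t ≡ o → ∀ x y → Emb.Search.X F v pos t x →
       Emb.InteriorVertex F o (Emb.OuterCE F o) y → ¬ Emb.Search.X F v pos t y →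
       Before L x y)
    × (t ≢ o → ∀ (p q : Fin n) (s : Fin m) → s ∈ pre →
       Emb.DEdge F t p q → Emb.DEdge F s q p → ¬ Emb.Search.TreeEdge F v pos p q →
       ∀ x y → Emb.Search.X F v pos t x →
       Emb.InteriorVertex F o (Emb.Search.PathCE F v pos p q) y →
       ¬ Emb.Search.X F v pos t y → Before L x y)
lemma6p2 F ST o v pos LB res dfs a b c ca cb cc _ _ _ L bL u t pre post res≡ Xtu ¬Xpre-u =
  outer-case , inner-case
  where
  open Emb F
  open Search v pos
  open Listing F v pos

  -- every vertex lies on a face reached by the DFS, hence is listed in L
  listed : ∀ y → y ∈ L
  listed y with Covering.every-vertex-covered F ST v pos LB res (dfs-complete dfs) (dfs-root dfs) y
  ... | E , cE , E∈ = buildL-lists bL E E∈ (anc-corner here cE)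

  -- f(u) = o: L starts with X_o
  outer-case : t ≡ o → ∀ x y → X t x → InteriorVertex o (OuterCE o) y → ¬ X t y → Before L x y
  outer-case refl x y Xx _ ¬Xy with dfs-extends dfs
  ... | rest , res≡o∷rest =
    buildL-precedes ca cb cc bL [] o rest res≡o∷rest Xx (listed y) ¬Xy (λ _ ()) ¬Xy

  -- f(u) ≠ o: o and the faces reached before t are exterior to C(u)
  inner-case : t ≢ o → ∀ (p q : V) (s : Face) → s ∈ pre → DEdge t p q → DEdge s q p →
    ¬ TreeEdge p q → ∀ x y → X t x → InteriorVertex o (PathCE p q) y → ¬ X t y → Before L x y
  inner-case t≢o p q _ _ tpq _ _ x y Xx y-interior ¬Xy =
    buildL-precedes ca cb cc bL pre t post res≡ Xx (listed y) (misses ε) (λ s → misses ∘ pre-exterior s) ¬Xy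
    where
    open InsideCycle F ST v pos o t p q tpq
    misses : ∀ {s} → Exterior o (PathCE p q) s → ¬ X s y
    misses = exterior-misses (inside-interior y-interior) ¬Xy
    t∉pre : t ∉ pre
    t∉pre t∈ = All.lookup ¬Xpre-u t∈ Xtu
    pre-exterior : ∀ s → s ∈ pre → Exterior o (PathCE p q) s
    pre-exterior s s∈ =
      avoiding-exterior (t≢o ∘ sym) (dfs-reaches-avoiding Fin._≟_ dfs t pre post res≡ t∉pre t≢o s s∈)
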